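{- Let $N\geq2$ and let $\rho$ be the unique positive real root of $X^N-X^{N-1}-\cdots-X-1$. Let $0=x_0<x_1<x_2<\cdots$ be the increasing enumeration of all $\rho$-integers and $S_i=[x_{i-1},x_i]$. Then the tiling $(S_i)_{i\geq1}$ of $[0,\infty)$ is not periodic, i.e. there is no $m\in\mathbb N$ such that $S_i$ and $S_{i+m}$ have the same length for all $i\geq1$.
   Context: A non-negative real number is a $\rho$-integer if it equals $\sum_{i=0}^{n}c_i\rho^{n-i}$ for some $n\in\mathbb N_0$ and coefficients $c_i\in\{0,1\}$. -}

module Defs where

open import Data.Nat as ℕ using (ℕ; zero; suc; _∸_)
open import Data.Bool using (Bool; true; false; if_then_else_)
open import Data.List using (List; []; _∷_; reverse; map)
open import Data.Product using (_×_; _,_; ∃)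
open import Data.Rational using (ℚ; 0ℚ; 1ℚ; ½; _+_; _*_; _-_; _≤_; _<_; _≤ᵇ_)

-- Real numbers are not available; ρ (the unique positive root of
-- P_N(X) = X^N - X^(N-1) - ... - X - 1) is given as a computable real by
-- nested rational intervals obtained by bisection of [1,2]
-- (P_N(1) = 1 - N < 0 < 1 = P_N(2) for N ≥ 2).

pow : ℚ → ℕ → ℚ
pow x zero = 1ℚ
pow x (suc n) = x * pow x n

geomSum : ℚ → ℕ → ℚ
geomSum x zero = 0ℚ
geomSum x (suc n) = pow x n + geomSum x n

charPoly : ℕ → ℚ → ℚ
charPoly N x = pow x N - geomSum x N

-- k-th bisection interval [l_k , u_k] containing ρ, of width 2^-k,
-- with invariant P_N(l_k) ≤ 0 < P_N(u_k).
rhoInterval : ℕ → ℕ → ℚ × ℚ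
rhoInterval N zero = (1ℚ , 1ℚ + 1ℚ)
rhoInterval N (suc k) with rhoInterval N k
... | (l , u) =
  let m = ½ * (l + u) in
  if charPoly N m ≤ᵇ 0ℚ then (m , u) else (l , m)

-- Polynomials with rational coefficients, ascending powers.
Poly : Set
Poly = List ℚ

_⊖_ : Poly → Poly → Poly
[] ⊖ [] = []
[] ⊖ (d ∷ q) = (0ℚ - d) ∷ ([] ⊖ q)
(c ∷ p) ⊖ [] = c ∷ (p ⊖ [])
(c ∷ p) ⊖ (d ∷ q) = (c - d) ∷ (p ⊖ q)

-- Interval bounds for the value of p on [l,u] (0 < l):
-- go p a b with a = l^i, b = u^i.
lowerGo : ℚ → ℚ → Poly → ℚ → ℚ → ℚ
lowerGo l u [] a b = 0ℚ
lowerGo l u (c ∷ p) a b =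
  (if 0ℚ ≤ᵇ c then c * a else c * b) + lowerGo l u p (a * l) (b * u)

upperGo : ℚ → ℚ → Poly → ℚ → ℚ → ℚ
upperGo l u [] a b = 0ℚ
upperGo l u (c ∷ p) a b =
  (if 0ℚ ≤ᵇ c then c * b else c * a) + upperGo l u p (a * l) (b * u)

lowerBound : ℕ → ℕ → Poly → ℚ
lowerBound N k p with rhoInterval N k
... | (l , u) = lowerGo l u p 1ℚ 1ℚ

upperBound : ℕ → ℕ → Poly → ℚ
upperBound N k p with rhoInterval N k
... | (l , u) = upperGo l u p 1ℚ 1ℚ

PosAtRho : ℕ → Poly → Set
PosAtRho N p = ∃ λ k → 0ℚ < lowerBound N k p

ZeroAtRho : ℕ → Poly → Set
ZeroAtRho N p = ∀ k → (lowerBound N k p ≤ 0ℚ) × (0ℚ ≤ upperBound N k p)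

-- A ρ-integer is given by its digit string c_0 c_1 ... c_n (c_i ∈ {0,1},
-- most significant first); its value is Σ c_i ρ^(n-i), i.e. the polynomial
-- with ascending coefficients reverse (c_0 … c_n) evaluated at ρ.
Digits : Set
Digits = List Bool

digitsPoly : Digits → Poly
digitsPoly ds = reverse (map (λ b → if b then 1ℚ else 0ℚ) ds)

tileLength : (ℕ → Digits) → ℕ → Poly
tileLength x i = digitsPoly (x i) ⊖ digitsPoly (x (i ∸ 1))

{-# OPTIONS --safe #-}
-- Suppose the tile lengths had period m. Then x_(i+m) = x_i + L with L = x_m - x_0 > 0, so every
-- ρ-integer is x_r + q L with r < m. Multiplying a ρ-integer by ρ appends a digit 0, so
-- ρ (x_0 + a L) = x_(r_a) + q_a L for a = 0, …, m; two of these m + 1 residues r_a < m coincide,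
-- and subtracting gives (a₂ - a₁) ρ L = (q₂ - q₁) L, so ρ would be rational. But a rational root
-- n / D in lowest terms of X^N - X^(N-1) - … - 1 has D ∣ n^N, hence D = 1; then n ∣ 1, so n = 1
-- and 1 = N, impossible for N ≥ 2.
-- ρ is only accessible through its bisection intervals [lo k, hi k], so every equation between
-- reals above is replaced by an equation between sequences up to an error O(hi k - lo k).
module Submission where

module ρ-Tiling where

  open import Level using (0ℓ)
  open import Defs
  open import Data.Maybe.Base using (Maybe; just; nothing)
  open import Data.Nat as ℕ using (ℕ; zero; suc; _^_)
  import Data.Nat.Properties as ℕ
  open import Data.Integer as ℤ using (+_)
  import Data.Integer.Properties as ℤ
  import Data.Integer.Tactic.RingSolver as ℤ-Solver
  open import Data.Rational as ℚ
    using (ℚ; 0ℚ; 1ℚ; ½; _+_; _*_; _-_; -_; 1/_; _≤_; _<_; _≤ᵇ_; ∣_∣; mkℚ; ↥_; *≤*)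
  open import Data.Rational.Literals using (fromℤ)
  import Data.Rational.Properties as ℚ
  import Data.Rational.Unnormalised as ℚᵘ
  import Data.Rational.Unnormalised.Properties as ℚᵘ
  open import Data.Bool using (Bool; true; false; T; if_then_else_)
  open import Data.List using ([]; _∷_; _++_; reverse; map; replicate)
  import Data.List.Properties as List
  open import Data.Unit using (tt)
  open import Data.Product using (_×_; _,_; ∃; proj₁; proj₂)
  open import Data.Nat.DivMod using (_/_; _%_; m≡m%n+[m/n]*n; m%n<n)
  open import Data.Fin using (toℕ; fromℕ<)
  import Data.Fin.Properties as Fin
  open import Data.Nat.Coprimality as Coprimality using (Coprime; coprime-divisor)
  open import Data.Nat.Divisibility using (_∣_; divides; ∣1⇒≡1; ∣m+n∣m⇒∣n; m∣m*n)
  import Data.Nat.Tactic.RingSolver as ℕ-Solver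
  open import Data.Sum using (inj₁; inj₂)
  open import Function using (const)
  open import Data.Empty using (⊥; ⊥-elim)
  open import Relation.Nullary using (¬_; yes; no)
  open import Relation.Binary using (Setoid; tri<; tri≈; tri>)
  import Relation.Binary.Reasoning.Setoid as SetoidReasoning
  open import Relation.Binary.PropositionalEquality
  open import Tactic.RingSolver using (solve-∀)
  import Tactic.RingSolver.Core.AlmostCommutativeRing as ACR

  ℚ-ring : ACR.AlmostCommutativeRing 0ℓ 0ℓ
  ℚ-ring = ACR.fromCommutativeRing ℚ.+-*-commutativeRing isZero
    where
    isZero : ∀ p → Maybe (0ℚ ≡ p)
    isZero p with 0ℚ ℚ.≟ p
    ... | yes 0≡p = just 0≡p
    ... | no _    = nothing

  *-pres-0≤ : ∀ {p q} → 0ℚ ≤ p → 0ℚ ≤ q → 0ℚ ≤ p * q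
  *-pres-0≤ {p} {q} 0≤p 0≤q =
    subst (_≤ p * q) (ℚ.*-zeroʳ p) (ℚ.*-monoˡ-≤-nonNeg p {{ℚ.nonNegative 0≤p}} 0≤q)

  p≤q⇒0≤q-p : ∀ {p q} → p ≤ q → 0ℚ ≤ q - p
  p≤q⇒0≤q-p {p} {q} p≤q = subst (_≤ q - p) (ℚ.+-inverseʳ p) (ℚ.+-monoˡ-≤ (- p) p≤q)

  0≤q-p⇒p≤q : ∀ {p q} → 0ℚ ≤ q - p → p ≤ q
  0≤q-p⇒p≤q {p} {q} 0≤q-p = subst₂ _≤_ (ℚ.+-identityˡ p) (cancel p q) (ℚ.+-monoˡ-≤ p 0≤q-p)
    where
    cancel : ∀ p q → q - p + p ≡ q
    cancel = solve-∀ ℚ-ring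

  -- Inequalities are proved by a certificate: q - p rewritten, as a ring
  -- identity, into a sum of products of manifestly non-negative factors.
  ≤-by : ∀ {p q r} → q - p ≡ r → 0ℚ ≤ r → p ≤ q
  ≤-by q-p≡r 0≤r = 0≤q-p⇒p≤q (subst (0ℚ ≤_) (sym q-p≡r) 0≤r)

  p-q≡0⇒p≡q : ∀ {p q} → p - q ≡ 0ℚ → p ≡ q
  p-q≡0⇒p≡q {p} {q} p-q≡0 = trans (ring p q) (trans (cong (_+ q) p-q≡0) (ℚ.+-identityˡ q))
    where
    ring : ∀ p q → p ≡ p - q + q
    ring = solve-∀ ℚ-ring

  *-mono-≤-nonNeg : ∀ {a b c d} → 0ℚ ≤ a → a ≤ b → 0ℚ ≤ c → c ≤ d → a * c ≤ b * d
  *-mono-≤-nonNeg {a} {b} {c} {d} 0≤a a≤b 0≤c c≤d = ℚ.≤-trans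
    (ℚ.*-monoˡ-≤-nonNeg a {{ℚ.nonNegative 0≤a}} c≤d)
    (ℚ.*-monoʳ-≤-nonNeg d {{ℚ.nonNegative (ℚ.≤-trans 0≤c c≤d)}} a≤b)

  2ℚ : ℚ
  2ℚ = 1ℚ + 1ℚ

  0≤½ : 0ℚ ≤ ½
  0≤½ = *≤* (ℤ.+≤+ ℕ.z≤n)

  0≤1ℚ : 0ℚ ≤ 1ℚ
  0≤1ℚ = *≤* (ℤ.+≤+ ℕ.z≤n)

  0≤2ℚ : 0ℚ ≤ 2ℚ
  0≤2ℚ = *≤* (ℤ.+≤+ ℕ.z≤n)

  ≤ᵇ≡true⇒≤ : ∀ {p q} → (p ≤ᵇ q) ≡ true → p ≤ q
  ≤ᵇ≡true⇒≤ {p} {q} p≤ᵇq = ℚ.≤ᵇ⇒≤ {p} {q} (subst T (sym p≤ᵇq) tt)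

  ≤ᵇ≡false⇒> : ∀ {p q} → (p ≤ᵇ q) ≡ false → q < p
  ≤ᵇ≡false⇒> {p} {q} p≰ᵇq = ℚ.≰⇒> (λ p≤q → subst T p≰ᵇq (ℚ.≤⇒≤ᵇ {p} {q} p≤q))

  p≤0⇒∣p∣≡-p : ∀ {p} → p ≤ 0ℚ → ∣ p ∣ ≡ - p
  p≤0⇒∣p∣≡-p {p} p≤0 = trans (sym (ℚ.∣-p∣≡∣p∣ p)) (ℚ.0≤p⇒∣p∣≡p (ℚ.neg-antimono-≤ p≤0))

  p≤∣p∣ : ∀ p → p ≤ ∣ p ∣
  p≤∣p∣ p with ℚ.≤-total 0ℚ p
  ... | inj₁ 0≤p = ℚ.≤-reflexive (sym (ℚ.0≤p⇒∣p∣≡p 0≤p))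
  ... | inj₂ p≤0 = ℚ.≤-trans p≤0 (ℚ.0≤∣p∣ p)

  ∣p∣≤u-l : ∀ {l p u} → l ≤ p → p ≤ u → l ≤ 0ℚ → 0ℚ ≤ u → ∣ p ∣ ≤ u - l
  ∣p∣≤u-l {l} {p} {u} l≤p p≤u l≤0 0≤u with ℚ.≤-total 0ℚ p
  ... | inj₁ 0≤p = subst (_≤ u - l) (sym (ℚ.0≤p⇒∣p∣≡p 0≤p))
                     (≤-by (ring₁ l p u) (ℚ.+-mono-≤ (p≤q⇒0≤q-p p≤u) (p≤q⇒0≤q-p l≤0)))
    where
    ring₁ : ∀ l p u → u - l - p ≡ u - p + (0ℚ - l)
    ring₁ = solve-∀ ℚ-ring
  ... | inj₂ p≤0 = subst (_≤ u - l) (sym (p≤0⇒∣p∣≡-p p≤0))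
                     (≤-by (ring₂ l p u) (ℚ.+-mono-≤ (p≤q⇒0≤q-p l≤p) (p≤q⇒0≤q-p 0≤u)))
    where
    ring₂ : ∀ l p u → u - l - (- p) ≡ p - l + (u - 0ℚ)
    ring₂ = solve-∀ ℚ-ring

  fromℕ : ℕ → ℚ
  fromℕ n = fromℤ (+ n)

  fromℕ-+ : ∀ m n → fromℕ (m ℕ.+ n) ≡ fromℕ m + fromℕ n
  fromℕ-+ m n = ℚ.toℚᵘ-injective (ℚᵘ.≃-trans (ℚᵘ.*≡* eq) (ℚᵘ.≃-sym (ℚ.toℚᵘ-homo-+ (fromℕ m) (fromℕ n))))
    where
    eq : + (m ℕ.+ n) ℤ.* + 1 ≡ (+ m ℤ.* + 1 ℤ.+ + n ℤ.* + 1) ℤ.* + 1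
    eq rewrite ℤ.pos-+ m n = ring (+ m) (+ n)
      where
      ring : ∀ a b → (a ℤ.+ b) ℤ.* + 1 ≡ (a ℤ.* + 1 ℤ.+ b ℤ.* + 1) ℤ.* + 1
      ring = ℤ-Solver.solve-∀

  fromℕ-* : ∀ m n → fromℕ (m ℕ.* n) ≡ fromℕ m * fromℕ n
  fromℕ-* m n = ℚ.toℚᵘ-injective (ℚᵘ.≃-trans (ℚᵘ.*≡* eq) (ℚᵘ.≃-sym (ℚ.toℚᵘ-homo-* (fromℕ m) (fromℕ n))))
    where
    eq : + (m ℕ.* n) ℤ.* + 1 ≡ (+ m ℤ.* + n) ℤ.* + 1
    eq = cong (ℤ._* + 1) (ℤ.pos-* m n)

  fromℕ-suc : ∀ n → fromℕ (suc n) ≡ 1ℚ + fromℕ n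
  fromℕ-suc = fromℕ-+ 1

  fromℕ-injective : ∀ {m n} → fromℕ m ≡ fromℕ n → m ≡ n
  fromℕ-injective eq = ℤ.+-injective (cong ↥_ eq)

  0≤fromℕ : ∀ n → 0ℚ ≤ fromℕ n
  0≤fromℕ n = ℚ.nonNegative⁻¹ (fromℕ n)

  fromℕ-mono-≤ : ∀ {m n} → m ℕ.≤ n → fromℕ m ≤ fromℕ n
  fromℕ-mono-≤ m≤n = *≤* (ℤ.*-monoʳ-≤-nonNeg (+ 1) (ℤ.+≤+ m≤n))

  archimedean : ∀ p → ∃ λ n → p ≤ fromℕ n
  archimedean (mkℚ (+ n) _ _) = n , *≤* (ℤ.*-monoˡ-≤-nonNeg (+ n) (ℤ.+≤+ (ℕ.s≤s ℕ.z≤n)))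
  archimedean p@(mkℚ ℤ.-[1+ _ ] _ _) = 0 , ℚ.<⇒≤ (ℚ.negative⁻¹ p)

  denominator-clears : ∀ n d .(c : Coprime n (suc d)) → mkℚ (+ n) d c * fromℕ (suc d) ≡ fromℕ n
  denominator-clears n d c = ℚ.toℚᵘ-injective (ℚᵘ.≃-trans (ℚ.toℚᵘ-homo-* (mkℚ (+ n) d c) (fromℕ (suc d))) (ℚᵘ.*≡* eq))
    where
    eq : + n ℤ.* + suc d ℤ.* + 1 ≡ + n ℤ.* (+ suc d ℤ.* + 1)
    eq = ℤ.*-assoc (+ n) (+ suc d) (+ 1)

  -- Rational roots of X^N - X^(N-1) - … - 1

  -- homGeomSum n D k = Σ_(i<k) n^i D^(k-1-i) = D^(k-1) (1 + r + … + r^(k-1)) for r = n / D.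
  homGeomSum : ℕ → ℕ → ℕ → ℕ
  homGeomSum n D zero = 0
  homGeomSum n D (suc k) = n ^ k ℕ.+ D ℕ.* homGeomSum n D k

  homGeomSum-1 : ∀ n k → homGeomSum n 1 (suc k) ≡ 1 ℕ.+ n ℕ.* homGeomSum n 1 k
  homGeomSum-1 n zero = cong suc (sym (ℕ.*-zeroʳ n))
  homGeomSum-1 n (suc k) = trans (cong (λ G → n ^ suc k ℕ.+ 1 ℕ.* G) (homGeomSum-1 n k)) (ring n (n ^ k) (homGeomSum n 1 k))
    where
    ring : ∀ n nᵏ G → n ℕ.* nᵏ ℕ.+ 1 ℕ.* (1 ℕ.+ n ℕ.* G) ≡ 1 ℕ.+ n ℕ.* (nᵏ ℕ.+ 1 ℕ.* G)
    ring = ℕ-Solver.solve-∀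

  homGeomSum-1-1 : ∀ k → homGeomSum 1 1 k ≡ k
  homGeomSum-1-1 zero = refl
  homGeomSum-1-1 (suc k) = cong₂ ℕ._+_ (ℕ.^-zeroˡ k) (trans (ℕ.*-identityˡ _) (homGeomSum-1-1 k))

  coprime-divides-pow⇒∣1 : ∀ {D n} k → Coprime D n → D ∣ n ^ k → D ∣ 1
  coprime-divides-pow⇒∣1 zero _ D∣1 = D∣1
  coprime-divides-pow⇒∣1 (suc k) D⊥n D∣nᵏ⁺¹ = coprime-divides-pow⇒∣1 k D⊥n (coprime-divisor D⊥n D∣nᵏ⁺¹)

  no-integral-root : ∀ n {N} → 2 ℕ.≤ N → n ^ N ≢ homGeomSum n 1 N
  no-integral-root n {suc zero} (ℕ.s≤s ())
  no-integral-root n {suc (suc N)} _ nᴺ≡G = 1≢2+N (begin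
    1                              ≡⟨ sym (ℕ.^-zeroˡ (2 ℕ.+ N)) ⟩
    1 ^ (2 ℕ.+ N)                  ≡⟨ subst (λ n → n ^ (2 ℕ.+ N) ≡ homGeomSum n 1 (2 ℕ.+ N)) n≡1 nᴺ≡G ⟩
    homGeomSum 1 1 (2 ℕ.+ N)       ≡⟨ homGeomSum-1-1 (2 ℕ.+ N) ⟩
    2 ℕ.+ N                        ∎)
    where
    open ≡-Reasoning
    nᴺ≡nG+1 : n ℕ.* n ^ suc N ≡ n ℕ.* homGeomSum n 1 (suc N) ℕ.+ 1
    nᴺ≡nG+1 = trans nᴺ≡G (trans (homGeomSum-1 n (suc N)) (ℕ.+-comm 1 _))
    n≡1 : n ≡ 1
    n≡1 = ∣1⇒≡1 (∣m+n∣m⇒∣n (subst (n ∣_) nᴺ≡nG+1 (m∣m*n _)) (m∣m*n _))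
    1≢2+N : 1 ≢ 2 ℕ.+ N
    1≢2+N ()

  module _ {r D n} (rD≡n : r * fromℕ D ≡ fromℕ n) where
    open ≡-Reasoning

    clear-pow : ∀ k → pow r k * fromℕ (D ^ k) ≡ fromℕ (n ^ k)
    clear-pow zero = refl
    clear-pow (suc k) = begin
      r * pow r k * fromℕ (D ℕ.* D ^ k)          ≡⟨ cong (r * pow r k *_) (fromℕ-* D (D ^ k)) ⟩
      r * pow r k * (fromℕ D * fromℕ (D ^ k))    ≡⟨ ring r (pow r k) (fromℕ D) (fromℕ (D ^ k)) ⟩
      r * fromℕ D * (pow r k * fromℕ (D ^ k))    ≡⟨ cong₂ _*_ rD≡n (clear-pow k) ⟩
      fromℕ n * fromℕ (n ^ k)                    ≡⟨ fromℕ-* n (n ^ k) ⟨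
      fromℕ (n ℕ.* n ^ k)                        ∎
      where
      ring : ∀ r rᵏ D Dᵏ → r * rᵏ * (D * Dᵏ) ≡ r * D * (rᵏ * Dᵏ)
      ring = solve-∀ ℚ-ring

    clear-geomSum : ∀ k → geomSum r k * fromℕ (D ^ k) ≡ fromℕ (D ℕ.* homGeomSum n D k)
    clear-geomSum zero = cong fromℕ (sym (ℕ.*-zeroʳ D))
    clear-geomSum (suc k) = begin
      (pow r k + geomSum r k) * fromℕ (D ℕ.* D ^ k)
        ≡⟨ cong ((pow r k + geomSum r k) *_) (fromℕ-* D (D ^ k)) ⟩
      (pow r k + geomSum r k) * (fromℕ D * fromℕ (D ^ k))
        ≡⟨ ring (pow r k) (geomSum r k) (fromℕ D) (fromℕ (D ^ k)) ⟩
      fromℕ D * (pow r k * fromℕ (D ^ k) + geomSum r k * fromℕ (D ^ k))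
        ≡⟨ cong (fromℕ D *_) (cong₂ _+_ (clear-pow k) (clear-geomSum k)) ⟩
      fromℕ D * (fromℕ (n ^ k) + fromℕ (D ℕ.* homGeomSum n D k))
        ≡⟨ cong (fromℕ D *_) (fromℕ-+ (n ^ k) _) ⟨
      fromℕ D * fromℕ (homGeomSum n D (suc k))
        ≡⟨ fromℕ-* D _ ⟨
      fromℕ (D ℕ.* homGeomSum n D (suc k))
        ∎
      where
      ring : ∀ rᵏ G D Dᵏ → (rᵏ + G) * (D * Dᵏ) ≡ D * (rᵏ * Dᵏ + G * Dᵏ)
      ring = solve-∀ ℚ-ring

  rational-root-cleared : ∀ N n d .(c : Coprime n (suc d)) → charPoly N (mkℚ (+ n) d c) ≡ 0ℚ →
                          n ^ N ≡ suc d ℕ.* homGeomSum n (suc d) N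
  rational-root-cleared N n d c Pr≡0 = fromℕ-injective (begin
    fromℕ (n ^ N)                             ≡⟨ clear-pow rD≡n N ⟨
    pow r N * fromℕ (suc d ^ N)               ≡⟨ cong (_* fromℕ (suc d ^ N)) rᴺ≡geomSum ⟩
    geomSum r N * fromℕ (suc d ^ N)           ≡⟨ clear-geomSum rD≡n N ⟩
    fromℕ (suc d ℕ.* homGeomSum n (suc d) N)  ∎)
    where
    open ≡-Reasoning
    r : ℚ
    r = mkℚ (+ n) d c
    rD≡n : r * fromℕ (suc d) ≡ fromℕ n
    rD≡n = denominator-clears n d c
    rᴺ≡geomSum : pow r N ≡ geomSum r N
    rᴺ≡geomSum = p-q≡0⇒p≡q Pr≡0

  charPoly-no-nonNeg-root : ∀ {N} → 2 ℕ.≤ N → ∀ r → 0ℚ ≤ r → charPoly N r ≢ 0ℚ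
  charPoly-no-nonNeg-root {N} 2≤N (mkℚ (+ n) d c) _ Pr≡0
    with ∣1⇒≡1 (coprime-divides-pow⇒∣1 N (Coprimality.sym (Coprimality.recompute c))
                 (divides (homGeomSum n (suc d) N) (trans (rational-root-cleared N n d c Pr≡0) (ℕ.*-comm (suc d) _))))
  ... | refl = no-integral-root n 2≤N (trans (rational-root-cleared N n 0 c Pr≡0) (ℕ.*-identityˡ _))
  charPoly-no-nonNeg-root _ r@(mkℚ ℤ.-[1+ _ ] _ _) 0≤r _ = ℚ.<-irrefl refl (ℚ.≤-<-trans 0≤r (ℚ.negative⁻¹ r))

  -- Polynomials and interval evaluation

  eval : Poly → ℚ → ℚ
  eval []      t = 0ℚ
  eval (c ∷ p) t = c + t * eval p t

  eval-⊖ : ∀ p q t → eval (p ⊖ q) t ≡ eval p t - eval q t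
  eval-⊖ []      []      t = refl
  eval-⊖ []      (d ∷ q) t = trans (cong (λ e → 0ℚ - d + t * e) (eval-⊖ [] q t)) (ring d t (eval q t))
    where
    ring : ∀ d t e → 0ℚ - d + t * (0ℚ - e) ≡ 0ℚ - (d + t * e)
    ring = solve-∀ ℚ-ring
  eval-⊖ (c ∷ p) []      t = trans (cong (λ e → c + t * e) (eval-⊖ p [] t)) (ring c t (eval p t))
    where
    ring : ∀ c t e → c + t * (e - 0ℚ) ≡ c + t * e - 0ℚ
    ring = solve-∀ ℚ-ring
  eval-⊖ (c ∷ p) (d ∷ q) t = trans (cong (λ e → c - d + t * e) (eval-⊖ p q t)) (ring c d t (eval p t) (eval q t))
    where
    ring : ∀ c d t e f → c - d + t * (e - f) ≡ c + t * e - (d + t * f)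
    ring = solve-∀ ℚ-ring

  eval-digitsPoly-shift : ∀ ds t → eval (digitsPoly (ds ++ false ∷ [])) t ≡ t * eval (digitsPoly ds) t
  eval-digitsPoly-shift ds t = begin
    eval (reverse (map digit (ds ++ false ∷ []))) t  ≡⟨ cong (λ p → eval (reverse p) t) (List.map-++ digit ds (false ∷ [])) ⟩
    eval (reverse (map digit ds ++ 0ℚ ∷ [])) t       ≡⟨ cong (λ p → eval p t) (List.reverse-++ (map digit ds) (0ℚ ∷ [])) ⟩
    0ℚ + t * eval (digitsPoly ds) t                  ≡⟨ ℚ.+-identityˡ _ ⟩
    t * eval (digitsPoly ds) t                       ∎
    where
    open ≡-Reasoning
    digit : Bool → ℚ
    digit b = if b then 1ℚ else 0ℚ

  geomSum-suc : ∀ t k → geomSum t (suc k) ≡ 1ℚ + t * geomSum t k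
  geomSum-suc t zero = ring t
    where
    ring : ∀ t → 1ℚ + 0ℚ ≡ 1ℚ + t * 0ℚ
    ring = solve-∀ ℚ-ring
  geomSum-suc t (suc k) = trans (cong (λ G → pow t (suc k) + G) (geomSum-suc t k)) (ring t (pow t k) (geomSum t k))
    where
    ring : ∀ t tᵏ G → t * tᵏ + (1ℚ + t * G) ≡ 1ℚ + t * (tᵏ + G)
    ring = solve-∀ ℚ-ring

  charPolyCoeffs : ℕ → Poly
  charPolyCoeffs N = replicate N (- 1ℚ) ++ 1ℚ ∷ []

  eval-replicate-++ : ∀ k c q t → eval (replicate k c ++ q) t ≡ c * geomSum t k + pow t k * eval q t
  eval-replicate-++ zero    c q t = ring c (eval q t)
    where
    ring : ∀ c e → e ≡ c * 0ℚ + 1ℚ * e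
    ring = solve-∀ ℚ-ring
  eval-replicate-++ (suc k) c q t = begin
    c + t * eval (replicate k c ++ q) t                   ≡⟨ cong (λ e → c + t * e) (eval-replicate-++ k c q t) ⟩
    c + t * (c * geomSum t k + pow t k * eval q t)        ≡⟨ ring c t (geomSum t k) (pow t k) (eval q t) ⟩
    c * (1ℚ + t * geomSum t k) + t * pow t k * eval q t   ≡⟨ cong (λ G → c * G + pow t (suc k) * eval q t) (geomSum-suc t k) ⟨
    c * geomSum t (suc k) + pow t (suc k) * eval q t      ∎
    where
    open ≡-Reasoning
    ring : ∀ c t G tᵏ e → c + t * (c * G + tᵏ * e) ≡ c * (1ℚ + t * G) + t * tᵏ * e
    ring = solve-∀ ℚ-ring

  eval-charPolyCoeffs : ∀ N t → eval (charPolyCoeffs N) t ≡ charPoly N t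
  eval-charPolyCoeffs N t = trans (eval-replicate-++ N (- 1ℚ) (1ℚ ∷ []) t) (ring (geomSum t N) (pow t N) t)
    where
    ring : ∀ G tᴺ t → - 1ℚ * G + tᴺ * (1ℚ + t * 0ℚ) ≡ tᴺ - G
    ring = solve-∀ ℚ-ring

  coefficient-bounds : ∀ c {a s b} → a ≤ s → s ≤ b →
                       (if 0ℚ ≤ᵇ c then c * a else c * b) ≤ c * s × c * s ≤ (if 0ℚ ≤ᵇ c then c * b else c * a)
  coefficient-bounds c a≤s s≤b with 0ℚ ≤ᵇ c in 0≤ᵇc
  ... | true  = ℚ.*-monoˡ-≤-nonNeg c a≤s , ℚ.*-monoˡ-≤-nonNeg c s≤b
    where
    instance
      c≥0 : ℚ.NonNegative c
      c≥0 = ℚ.nonNegative (≤ᵇ≡true⇒≤ {0ℚ} {c} 0≤ᵇc)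
  ... | false = ℚ.*-monoˡ-≤-nonPos c s≤b , ℚ.*-monoˡ-≤-nonPos c a≤s
    where
    instance
      c≤0 : ℚ.NonPositive c
      c≤0 = ℚ.nonPositive (ℚ.<⇒≤ (≤ᵇ≡false⇒> {0ℚ} {c} 0≤ᵇc))

  coefficient-width : ∀ c a b →
                      (if 0ℚ ≤ᵇ c then c * b else c * a) - (if 0ℚ ≤ᵇ c then c * a else c * b) ≡ ∣ c ∣ * (b - a)
  coefficient-width c a b with 0ℚ ≤ᵇ c in 0≤ᵇc
  ... | true  = trans (ring c a b) (cong (_* (b - a)) (sym (ℚ.0≤p⇒∣p∣≡p (≤ᵇ≡true⇒≤ {0ℚ} {c} 0≤ᵇc))))
    where
    ring : ∀ c a b → c * b - c * a ≡ c * (b - a)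
    ring = solve-∀ ℚ-ring
  ... | false = trans (ring c a b) (cong (_* (b - a)) (sym (p≤0⇒∣p∣≡-p (ℚ.<⇒≤ (≤ᵇ≡false⇒> {0ℚ} {c} 0≤ᵇc)))))
    where
    ring : ∀ c a b → c * a - c * b ≡ - c * (b - a)
    ring = solve-∀ ℚ-ring

  interval-enclosure : ∀ p {l u a b s t} → 0ℚ ≤ a → a ≤ s → s ≤ b → 0ℚ ≤ l → l ≤ t → t ≤ u →
                       lowerGo l u p a b ≤ s * eval p t × s * eval p t ≤ upperGo l u p a b
  interval-enclosure [] {s = s} _ _ _ _ _ _ = ℚ.≤-reflexive (sym (ℚ.*-zeroʳ s)) , ℚ.≤-reflexive (ℚ.*-zeroʳ s)
  interval-enclosure (c ∷ p) {l} {u} {a} {b} {s} {t} 0≤a a≤s s≤b 0≤l l≤t t≤u =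
    ℚ.≤-trans (ℚ.+-mono-≤ (proj₁ (coefficient-bounds c a≤s s≤b)) (proj₁ rest)) (ℚ.≤-reflexive split) ,
    ℚ.≤-trans (ℚ.≤-reflexive (sym split)) (ℚ.+-mono-≤ (proj₂ (coefficient-bounds c a≤s s≤b)) (proj₂ rest))
    where
    rest : lowerGo l u p (a * l) (b * u) ≤ s * t * eval p t × s * t * eval p t ≤ upperGo l u p (a * l) (b * u)
    rest = interval-enclosure p (*-pres-0≤ 0≤a 0≤l) (*-mono-≤-nonNeg 0≤a a≤s 0≤l l≤t)
             (*-mono-≤-nonNeg (ℚ.≤-trans 0≤a a≤s) s≤b (ℚ.≤-trans 0≤l l≤t) t≤u) 0≤l l≤t t≤u
    ring : ∀ c s t e → c * s + s * t * e ≡ s * (c + t * e)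
    ring = solve-∀ ℚ-ring
    split : c * s + s * t * eval p t ≡ s * eval (c ∷ p) t
    split = ring c s t (eval p t)

  enclosureWidth : Poly → ℚ → ℚ → ℚ
  enclosureWidth []      B E = 0ℚ
  enclosureWidth (c ∷ p) B E = ∣ c ∣ * E + enclosureWidth p (B * 2ℚ) (B + 2ℚ * E)

  -- Along the recursion a = l^i and b = u^i: B bounds u^i and E (u - l) bounds u^i - l^i.
  interval-width : ∀ p {l u a b B E} → 0ℚ ≤ a → a ≤ b → b ≤ B → b - a ≤ E * (u - l) → 0ℚ ≤ E →
                   0ℚ ≤ l → l ≤ u → u ≤ 2ℚ →
                   upperGo l u p a b - lowerGo l u p a b ≤ enclosureWidth p B E * (u - l)
  interval-width [] {l} {u} _ _ _ _ _ _ _ _ = ℚ.≤-reflexive (sym (ℚ.*-zeroˡ (u - l)))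
  interval-width (c ∷ p) {l} {u} {a} {b} {B} {E} 0≤a a≤b b≤B b-a≤Ew 0≤E 0≤l l≤u u≤2 = begin
    (cᵘ + U) - (cₗ + L)                  ≡⟨ ring₁ cᵘ cₗ U L ⟩
    (cᵘ - cₗ) + (U - L)                  ≡⟨ cong (_+ (U - L)) (coefficient-width c a b) ⟩
    ∣ c ∣ * (b - a) + (U - L)            ≤⟨ ℚ.+-mono-≤ (ℚ.*-monoˡ-≤-nonNeg ∣ c ∣ {{ℚ.∣-∣-nonNeg c}} b-a≤Ew) rest ⟩
    ∣ c ∣ * (E * (u - l)) + K * (u - l)  ≡⟨ ring₂ ∣ c ∣ E K (u - l) ⟩
    (∣ c ∣ * E + K) * (u - l)            ∎
    where
    open ℚ.≤-Reasoning
    cₗ cᵘ L U K : ℚ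
    cₗ = if 0ℚ ≤ᵇ c then c * a else c * b
    cᵘ = if 0ℚ ≤ᵇ c then c * b else c * a
    L = lowerGo l u p (a * l) (b * u)
    U = upperGo l u p (a * l) (b * u)
    K = enclosureWidth p (B * 2ℚ) (B + 2ℚ * E)
    ring₁ : ∀ cᵘ cₗ U L → (cᵘ + U) - (cₗ + L) ≡ (cᵘ - cₗ) + (U - L)
    ring₁ = solve-∀ ℚ-ring
    ring₂ : ∀ c E K w → c * (E * w) + K * w ≡ (c * E + K) * w
    ring₂ = solve-∀ ℚ-ring
    0≤b : 0ℚ ≤ b
    0≤b = ℚ.≤-trans 0≤a a≤b
    0≤u-l : 0ℚ ≤ u - l
    0≤u-l = p≤q⇒0≤q-p l≤u
    certificate : ∀ a b l u B E → (B + 2ℚ * E) * (u - l) - (b * u - a * l)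
                                ≡ (B - b) * (u - l) + (E * (u - l) * (2ℚ - l) + l * (E * (u - l) - (b - a)))
    certificate = solve-∀ ℚ-ring
    bu-al≤E′w : b * u - a * l ≤ (B + 2ℚ * E) * (u - l)
    bu-al≤E′w = ≤-by (certificate a b l u B E)
      (ℚ.+-mono-≤ (*-pres-0≤ (p≤q⇒0≤q-p b≤B) 0≤u-l)
        (ℚ.+-mono-≤ (*-pres-0≤ (*-pres-0≤ 0≤E 0≤u-l) (p≤q⇒0≤q-p (ℚ.≤-trans l≤u u≤2)))
                   (*-pres-0≤ 0≤l (p≤q⇒0≤q-p b-a≤Ew))))
    rest : U - L ≤ K * (u - l)
    rest = interval-width p (*-pres-0≤ 0≤a 0≤l) (*-mono-≤-nonNeg 0≤a a≤b 0≤l l≤u)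
             (*-mono-≤-nonNeg 0≤b b≤B (ℚ.≤-trans 0≤l l≤u) u≤2) bu-al≤E′w
             (ℚ.+-mono-≤ (ℚ.≤-trans 0≤b b≤B) (*-pres-0≤ 0≤2ℚ 0≤E)) 0≤l l≤u u≤2

  -- Bisection

  pow-1 : ∀ n → pow 1ℚ n ≡ 1ℚ
  pow-1 zero    = refl
  pow-1 (suc n) = trans (ℚ.*-identityˡ _) (pow-1 n)

  geomSum-1 : ∀ n → geomSum 1ℚ n ≡ fromℕ n
  geomSum-1 zero    = refl
  geomSum-1 (suc n) = trans (cong₂ _+_ (pow-1 n) (geomSum-1 n)) (sym (fromℕ-suc n))

  charPoly-1≤0 : ∀ {N} → 1 ℕ.≤ N → charPoly N 1ℚ ≤ 0ℚ
  charPoly-1≤0 {suc N} _ = ≤-by eq (0≤fromℕ N)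
    where
    ring : ∀ n → 0ℚ - (1ℚ - (1ℚ + n)) ≡ n
    ring = solve-∀ ℚ-ring
    eq : 0ℚ - charPoly (suc N) 1ℚ ≡ fromℕ N
    eq = trans (cong₂ (λ p g → 0ℚ - (p - g)) (pow-1 (suc N)) (trans (geomSum-1 (suc N)) (fromℕ-suc N))) (ring (fromℕ N))

  charPoly-2≡1 : ∀ N → charPoly N 2ℚ ≡ 1ℚ
  charPoly-2≡1 zero    = refl
  charPoly-2≡1 (suc N) = trans (ring (pow 2ℚ N) (geomSum 2ℚ N)) (charPoly-2≡1 N)
    where
    ring : ∀ p g → 2ℚ * p - (p + g) ≡ p - g
    ring = solve-∀ ℚ-ring

  bisect : ℕ → ℚ × ℚ → ℚ × ℚ
  bisect N (l , u) = if charPoly N (½ * (l + u)) ≤ᵇ 0ℚ then (½ * (l + u) , u) else (l , ½ * (l + u))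

  rhoInterval-suc : ∀ N k → rhoInterval N (suc k) ≡ bisect N (rhoInterval N k)
  rhoInterval-suc N k with rhoInterval N k
  ... | (l , u) = refl

  record IsBracket (N : ℕ) (i : ℚ × ℚ) : Set where
    field
      1≤lower     : 1ℚ ≤ proj₁ i
      lower≤upper : proj₁ i ≤ proj₂ i
      upper≤2     : proj₂ i ≤ 2ℚ
      P[lower]≤0  : charPoly N (proj₁ i) ≤ 0ℚ
      0≤P[upper]  : 0ℚ ≤ charPoly N (proj₂ i)

  record Refines (i j : ℚ × ℚ) : Set where
    field
      lower-mono : proj₁ i ≤ proj₁ j
      upper-mono : proj₂ j ≤ proj₂ i
      halves     : proj₂ j - proj₁ j ≡ ½ * (proj₂ i - proj₁ i)

  open IsBracket
  open Refines

  module _ {l u} (l≤u : l ≤ u) where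
    private
      certificate : ∀ l u → ½ * (l + u) - l ≡ ½ * (u - l)
      certificate = solve-∀ ℚ-ring
      certificate′ : ∀ l u → u - ½ * (l + u) ≡ ½ * (u - l)
      certificate′ = solve-∀ ℚ-ring

    ≤-midpoint : l ≤ ½ * (l + u)
    ≤-midpoint = ≤-by (certificate l u) (*-pres-0≤ 0≤½ (p≤q⇒0≤q-p l≤u))

    midpoint-≤ : ½ * (l + u) ≤ u
    midpoint-≤ = ≤-by (certificate′ l u) (*-pres-0≤ 0≤½ (p≤q⇒0≤q-p l≤u))

    bisect-step : ∀ {N} → IsBracket N (l , u) → IsBracket N (bisect N (l , u)) × Refines (l , u) (bisect N (l , u))
    bisect-step {N} b with charPoly N (½ * (l + u)) ≤ᵇ 0ℚ in P[m]≤ᵇ0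
    ... | true = record { 1≤lower = ℚ.≤-trans (1≤lower b) ≤-midpoint ; lower≤upper = midpoint-≤
                        ; upper≤2 = upper≤2 b ; P[lower]≤0 = ≤ᵇ≡true⇒≤ {charPoly N (½ * (l + u))} P[m]≤ᵇ0
                        ; 0≤P[upper] = 0≤P[upper] b }
               , record { lower-mono = ≤-midpoint ; upper-mono = ℚ.≤-refl ; halves = certificate′ l u }
    ... | false = record { 1≤lower = 1≤lower b ; lower≤upper = ≤-midpoint
                         ; upper≤2 = ℚ.≤-trans midpoint-≤ (upper≤2 b) ; P[lower]≤0 = P[lower]≤0 b
                         ; 0≤P[upper] = ℚ.<⇒≤ (≤ᵇ≡false⇒> {charPoly N (½ * (l + u))} P[m]≤ᵇ0) }
                , record { lower-mono = ℚ.≤-refl ; upper-mono = midpoint-≤ ; halves = certificate l u }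

  -- Sequences of rationals

  Seq : Set
  Seq = ℕ → ℚ

  infixl 6 _⊕_ _⊝_
  infixl 7 _⊛_

  _⊕_ _⊝_ _⊛_ : Seq → Seq → Seq
  (a ⊕ b) k = a k + b k
  (a ⊝ b) k = a k - b k
  (a ⊛ b) k = a k * b k

  Bounded : Seq → Set
  Bounded s = ∃ λ B → ∀ k → ∣ s k ∣ ≤ B

  const-bounded : ∀ c → Bounded (const c)
  const-bounded c = ∣ c ∣ , λ _ → ℚ.≤-refl

  EventuallyPositive : Seq → Set
  EventuallyPositive a = ∃ λ δ → 0ℚ < δ × ∃ λ K → ∀ k → K ℕ.≤ k → δ ≤ a k

  EventuallyPositive-resp-≗ : ∀ {a b} → a ≗ b → EventuallyPositive a → EventuallyPositive b
  EventuallyPositive-resp-≗ a≗b (δ , 0<δ , K , δ≤a) = δ , 0<δ , K , λ k K≤k → subst (δ ≤_) (a≗b k) (δ≤a k K≤k)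

  EventuallyPositive-+ : ∀ {a b} → EventuallyPositive a → EventuallyPositive b → EventuallyPositive (a ⊕ b)
  EventuallyPositive-+ (δ , 0<δ , K , δ≤a) (δ′ , 0<δ′ , K′ , δ′≤b) =
    δ + δ′ , ℚ.+-mono-< 0<δ 0<δ′ , K ℕ.⊔ K′ ,
    λ k K⊔K′≤k → ℚ.+-mono-≤ (δ≤a k (ℕ.m⊔n≤o⇒m≤o K K′ K⊔K′≤k)) (δ′≤b k (ℕ.m⊔n≤o⇒n≤o K K′ K⊔K′≤k))

  module Approximation {N} (1≤N : 1 ℕ.≤ N) where

    lo hi width : ℕ → ℚ
    lo k = proj₁ (rhoInterval N k)
    hi k = proj₂ (rhoInterval N k)
    width k = hi k - lo k

    bracket : ∀ k → IsBracket N (rhoInterval N k)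
    bracket zero = record { 1≤lower = ℚ.≤-refl ; lower≤upper = *≤* (ℤ.+≤+ (ℕ.s≤s ℕ.z≤n)) ; upper≤2 = ℚ.≤-refl
                          ; P[lower]≤0 = charPoly-1≤0 1≤N ; 0≤P[upper] = subst (0ℚ ≤_) (sym (charPoly-2≡1 N)) 0≤1ℚ }
    bracket (suc k) rewrite rhoInterval-suc N k = proj₁ (bisect-step (lower≤upper (bracket k)) (bracket k))

    refines : ∀ k → Refines (rhoInterval N k) (rhoInterval N (suc k))
    refines k rewrite rhoInterval-suc N k = proj₂ (bisect-step (lower≤upper (bracket k)) (bracket k))

    0≤lo : ∀ k → 0ℚ ≤ lo k
    0≤lo k = ℚ.≤-trans 0≤1ℚ (1≤lower (bracket k))

    0≤width : ∀ k → 0ℚ ≤ width k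
    0≤width k = p≤q⇒0≤q-p (lower≤upper (bracket k))

    nested′ : ∀ {k k′} → k ℕ.≤′ k′ → lo k ≤ lo k′ × hi k′ ≤ hi k
    nested′ ℕ.≤′-refl = ℚ.≤-refl , ℚ.≤-refl
    nested′ (ℕ.≤′-step {k′} k≤′k′) =
      ℚ.≤-trans (proj₁ (nested′ k≤′k′)) (lower-mono (refines k′)) ,
      ℚ.≤-trans (upper-mono (refines k′)) (proj₂ (nested′ k≤′k′))

    nested : ∀ {k k′} → k ℕ.≤ k′ → lo k ≤ lo k′ × hi k′ ≤ hi k
    nested k≤k′ = nested′ (ℕ.≤⇒≤′ k≤k′)

    -- width k = 2^-k and 2^k ≥ 1 + k.
    width-bound : ∀ k → (1ℚ + fromℕ k) * width k ≤ 1ℚ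
    width-bound zero    = ℚ.≤-refl
    width-bound (suc k) = ≤-by eq (ℚ.+-mono-≤ (p≤q⇒0≤q-p (width-bound k)) (*-pres-0≤ 0≤½ (*-pres-0≤ (0≤fromℕ k) (0≤width k))))
      where
      ring : ∀ n w → 1ℚ - (1ℚ + (1ℚ + n)) * (½ * w) ≡ (1ℚ - (1ℚ + n) * w) + ½ * (n * w)
      ring = solve-∀ ℚ-ring
      eq : 1ℚ - (1ℚ + fromℕ (suc k)) * width (suc k) ≡ (1ℚ - (1ℚ + fromℕ k) * width k) + ½ * (fromℕ k * width k)
      eq = trans (cong₂ (λ n w → 1ℚ - (1ℚ + n) * w) (fromℕ-suc k) (halves (refines k))) (ring (fromℕ k) (width k))

    Negligible : Seq → Set
    Negligible a = ∃ λ K → ∃ λ C → ∀ k → K ℕ.≤ k → ∣ a k ∣ ≤ C * width k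

    Negligible-resp-≗ : ∀ {a b} → a ≗ b → Negligible a → Negligible b
    Negligible-resp-≗ a≗b (K , C , small) = K , C , λ k K≤k → subst (λ x → ∣ x ∣ ≤ C * width k) (a≗b k) (small k K≤k)

    Negligible-neg : ∀ {a} → Negligible a → Negligible (const 0ℚ ⊝ a)
    Negligible-neg {a} (K , C , small) = K , C , λ k K≤k →
      subst (_≤ C * width k) (trans (sym (ℚ.∣-p∣≡∣p∣ (a k))) (cong ∣_∣ (sym (ℚ.+-identityˡ (- a k))))) (small k K≤k)

    Negligible-+ : ∀ {a b} → Negligible a → Negligible b → Negligible (a ⊕ b)
    Negligible-+ {a} {b} (K , C , a-small) (K′ , C′ , b-small) = K ℕ.⊔ K′ , C + C′ , λ k K⊔K′≤k → begin
      ∣ a k + b k ∣              ≤⟨ ℚ.∣p+q∣≤∣p∣+∣q∣ (a k) (b k) ⟩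
      ∣ a k ∣ + ∣ b k ∣          ≤⟨ ℚ.+-mono-≤ (a-small k (ℕ.m⊔n≤o⇒m≤o K K′ K⊔K′≤k)) (b-small k (ℕ.m⊔n≤o⇒n≤o K K′ K⊔K′≤k)) ⟩
      C * width k + C′ * width k ≡⟨ ℚ.*-distribʳ-+ (width k) C C′ ⟨
      (C + C′) * width k         ∎
      where open ℚ.≤-Reasoning

    Negligible-* : ∀ {s a} → Bounded s → Negligible a → Negligible (s ⊛ a)
    Negligible-* {s} {a} (B , s-bounded) (K , C , a-small) = K , B * C , λ k K≤k → begin
      ∣ s k * a k ∣        ≡⟨ ℚ.∣p*q∣≡∣p∣*∣q∣ (s k) (a k) ⟩
      ∣ s k ∣ * ∣ a k ∣    ≤⟨ *-mono-≤-nonNeg (ℚ.0≤∣p∣ (s k)) (s-bounded k) (ℚ.0≤∣p∣ (a k)) (a-small k K≤k) ⟩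
      B * (C * width k)    ≡⟨ ℚ.*-assoc B C (width k) ⟨
      B * C * width k      ∎
      where open ℚ.≤-Reasoning

    width-vanishes : ∀ C {ε} → 0ℚ < ε → ∃ λ K → ∀ k → K ℕ.≤ k → C * width k < ε
    width-vanishes C {ε} 0<ε with ℚ.≤-total C 0ℚ
    ... | inj₁ C≤0 = 0 , λ k _ → ℚ.≤-<-trans (Cw≤0 k) 0<ε
      where
      Cw≤0 : ∀ k → C * width k ≤ 0ℚ
      Cw≤0 k = subst (C * width k ≤_) (ℚ.*-zeroˡ (width k))
                     (ℚ.*-monoʳ-≤-nonNeg (width k) {{ℚ.nonNegative (0≤width k)}} C≤0)
    ... | inj₂ 0≤C = n , λ k n≤k →
      ℚ.*-cancelˡ-<-nonNeg (1ℚ + fromℕ k) {{ℚ.nonNegative (0≤1+k k)}} (begin-strict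
        (1ℚ + fromℕ k) * (C * width k)  ≡⟨ ring₁ (1ℚ + fromℕ k) C (width k) ⟩
        C * ((1ℚ + fromℕ k) * width k)  ≤⟨ ℚ.*-monoˡ-≤-nonNeg C {{ℚ.nonNegative 0≤C}} (width-bound k) ⟩
        C * 1ℚ                          ≡⟨ cong (C *_) (ℚ.*-inverseˡ ε) ⟨
        C * (1/ε * ε)                   ≡⟨ ℚ.*-assoc C 1/ε ε ⟨
        C * 1/ε * ε                     ≤⟨ ℚ.*-monoʳ-≤-nonNeg ε {{ℚ.nonNegative (ℚ.<⇒≤ 0<ε)}} (ℚ.≤-trans C/ε≤n (fromℕ-mono-≤ n≤k)) ⟩
        fromℕ k * ε                     ≡⟨ ℚ.+-identityˡ _ ⟨
        0ℚ + fromℕ k * ε                <⟨ ℚ.+-monoˡ-< (fromℕ k * ε) 0<ε ⟩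
        ε + fromℕ k * ε                 ≡⟨ ring₂ ε (fromℕ k) ⟩
        (1ℚ + fromℕ k) * ε              ∎)
      where
      open ℚ.≤-Reasoning
      instance
        ε≢0 : ℚ.NonZero ε
        ε≢0 = ℚ.pos⇒nonZero ε {{ℚ.positive 0<ε}}
      1/ε : ℚ
      1/ε = 1/ ε
      n : ℕ
      n = proj₁ (archimedean (C * 1/ε))
      C/ε≤n : C * 1/ε ≤ fromℕ n
      C/ε≤n = proj₂ (archimedean (C * 1/ε))
      0≤1+k : ∀ k → 0ℚ ≤ 1ℚ + fromℕ k
      0≤1+k k = ℚ.+-mono-≤ 0≤1ℚ (0≤fromℕ k)
      ring₁ : ∀ n C w → n * (C * w) ≡ C * (n * w)
      ring₁ = solve-∀ ℚ-ring
      ring₂ : ∀ ε n → ε + n * ε ≡ (1ℚ + n) * ε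
      ring₂ = solve-∀ ℚ-ring

    Negligible-apart : ∀ {a} → Negligible a → EventuallyPositive a → ⊥
    Negligible-apart {a} (K , C , small) (δ , 0<δ , K′ , δ≤a) = ℚ.<-irrefl refl (begin-strict
      δ            ≤⟨ δ≤a k K′≤k ⟩
      a k          ≤⟨ p≤∣p∣ (a k) ⟩
      ∣ a k ∣      ≤⟨ small k K≤k ⟩
      C * width k  <⟨ proj₂ (width-vanishes C 0<δ) k K″≤k ⟩
      δ            ∎)
      where
      open ℚ.≤-Reasoning
      K″ k : ℕ
      K″ = proj₁ (width-vanishes C 0<δ)
      k = K ℕ.⊔ (K′ ℕ.⊔ K″)
      K≤k : K ℕ.≤ k
      K≤k = ℕ.m≤m⊔n K (K′ ℕ.⊔ K″)
      K′≤k : K′ ℕ.≤ k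
      K′≤k = ℕ.≤-trans (ℕ.m≤m⊔n K′ K″) (ℕ.m≤n⊔m K (K′ ℕ.⊔ K″))
      K″≤k : K″ ℕ.≤ k
      K″≤k = ℕ.≤-trans (ℕ.m≤n⊔m K′ K″) (ℕ.m≤n⊔m K (K′ ℕ.⊔ K″))

    Negligible-cancelʳ : ∀ {a L} → EventuallyPositive L → Negligible (a ⊛ L) → Negligible a
    Negligible-cancelʳ {a} {L} (δ , 0<δ , K′ , δ≤L) (K , C , small) = K ℕ.⊔ K′ , C * 1/δ , λ k K⊔K′≤k →
      ℚ.*-cancelʳ-≤-pos δ {{ℚ.positive 0<δ}} (begin
        ∣ a k ∣ * δ            ≤⟨ ℚ.*-monoˡ-≤-nonNeg ∣ a k ∣ {{ℚ.∣-∣-nonNeg (a k)}}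
                                    (ℚ.≤-trans (δ≤L k (ℕ.m⊔n≤o⇒n≤o K K′ K⊔K′≤k)) (p≤∣p∣ (L k))) ⟩
        ∣ a k ∣ * ∣ L k ∣      ≡⟨ ℚ.∣p*q∣≡∣p∣*∣q∣ (a k) (L k) ⟨
        ∣ a k * L k ∣          ≤⟨ small k (ℕ.m⊔n≤o⇒m≤o K K′ K⊔K′≤k) ⟩
        C * width k            ≡⟨ ℚ.*-identityʳ _ ⟨
        C * width k * 1ℚ       ≡⟨ cong (C * width k *_) (ℚ.*-inverseˡ δ) ⟨
        C * width k * (1/δ * δ) ≡⟨ ring C (width k) 1/δ δ ⟩
        C * 1/δ * width k * δ  ∎)
      where
      open ℚ.≤-Reasoning
      instance
        δ≢0 : ℚ.NonZero δ
        δ≢0 = ℚ.pos⇒nonZero δ {{ℚ.positive 0<δ}}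
      1/δ : ℚ
      1/δ = 1/ δ
      ring : ∀ C w i δ → C * w * (i * δ) ≡ C * i * w * δ
      ring = solve-∀ ℚ-ring

    Negligible-const⇒≡0 : ∀ v → Negligible (const v) → v ≡ 0ℚ
    Negligible-const⇒≡0 v v-small with ℚ.<-cmp v 0ℚ
    ... | tri≈ _ v≡0 _ = v≡0
    ... | tri> _ _ 0<v = ⊥-elim (Negligible-apart v-small (v , 0<v , 0 , λ _ _ → ℚ.≤-refl))
    ... | tri< v<0 _ _ = ⊥-elim (Negligible-apart (Negligible-neg v-small)
                                   (- v , ℚ.neg-antimono-< v<0 , 0 , λ _ _ → ℚ.≤-reflexive (sym (ℚ.+-identityˡ (- v)))))

    infix 4 _≃_
    record _≃_ (a b : Seq) : Set where
      constructor mk≃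
      field negligible : Negligible (a ⊝ b)
    open _≃_

    ≗⇒≃ : ∀ {a b} → a ≗ b → a ≃ b
    ≗⇒≃ {a} {b} a≗b = mk≃ (0 , 0ℚ , λ k _ → ℚ.≤-reflexive (begin
      ∣ a k - b k ∣  ≡⟨ cong (λ x → ∣ x - b k ∣) (a≗b k) ⟩
      ∣ b k - b k ∣  ≡⟨ cong ∣_∣ (ℚ.+-inverseʳ (b k)) ⟩
      0ℚ             ≡⟨ ℚ.*-zeroˡ (width k) ⟨
      0ℚ * width k   ∎))
      where open ≡-Reasoning

    ≃-refl : ∀ {a} → a ≃ a
    ≃-refl = ≗⇒≃ (λ _ → refl)

    ≃-sym : ∀ {a b} → a ≃ b → b ≃ a
    ≃-sym {a} {b} (mk≃ a-b) = mk≃ (Negligible-resp-≗ (λ k → ring (a k) (b k)) (Negligible-neg a-b))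
      where
      ring : ∀ a b → 0ℚ - (a - b) ≡ b - a
      ring = solve-∀ ℚ-ring

    ≃-trans : ∀ {a b c} → a ≃ b → b ≃ c → a ≃ c
    ≃-trans {a} {b} {c} (mk≃ a-b) (mk≃ b-c) = mk≃ (Negligible-resp-≗ (λ k → ring (a k) (b k) (c k)) (Negligible-+ a-b b-c))
      where
      ring : ∀ a b c → a - b + (b - c) ≡ a - c
      ring = solve-∀ ℚ-ring

    ≃-setoid : Setoid 0ℓ 0ℓ
    ≃-setoid = record
      { Carrier = Seq
      ; _≈_ = _≃_
      ; isEquivalence = record { refl = ≃-refl ; sym = ≃-sym ; trans = ≃-trans }
      }

    module ≃-Reasoning = SetoidReasoning ≃-setoid

    ⊕-cong : ∀ {a b c d} → a ≃ b → c ≃ d → a ⊕ c ≃ b ⊕ d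
    ⊕-cong {a} {b} {c} {d} (mk≃ a-b) (mk≃ c-d) =
      mk≃ (Negligible-resp-≗ (λ k → ring (a k) (b k) (c k) (d k)) (Negligible-+ a-b c-d))
      where
      ring : ∀ a b c d → a - b + (c - d) ≡ a + c - (b + d)
      ring = solve-∀ ℚ-ring

    ⊝-cong : ∀ {a b c d} → a ≃ b → c ≃ d → a ⊝ c ≃ b ⊝ d
    ⊝-cong {a} {b} {c} {d} (mk≃ a-b) (mk≃ c-d) =
      mk≃ (Negligible-resp-≗ (λ k → ring (a k) (b k) (c k) (d k)) (Negligible-+ a-b (Negligible-neg c-d)))
      where
      ring : ∀ a b c d → a - b + (0ℚ - (c - d)) ≡ a - c - (b - d)
      ring = solve-∀ ℚ-ring

    ⊛-congˡ : ∀ {s a b} → Bounded s → a ≃ b → s ⊛ a ≃ s ⊛ b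
    ⊛-congˡ {s} {a} {b} s-bounded (mk≃ a-b) =
      mk≃ (Negligible-resp-≗ (λ k → ring (s k) (a k) (b k)) (Negligible-* s-bounded a-b))
      where
      ring : ∀ s a b → s * (a - b) ≡ s * a - s * b
      ring = solve-∀ ℚ-ring

    ⊛-congʳ : ∀ {s a b} → Bounded s → a ≃ b → a ⊛ s ≃ b ⊛ s
    ⊛-congʳ {s} {a} {b} s-bounded a≃b = begin
      a ⊛ s  ≈⟨ ≗⇒≃ (λ k → ℚ.*-comm (a k) (s k)) ⟩
      s ⊛ a  ≈⟨ ⊛-congˡ s-bounded a≃b ⟩
      s ⊛ b  ≈⟨ ≗⇒≃ (λ k → ℚ.*-comm (s k) (b k)) ⟩
      b ⊛ s  ∎
      where open ≃-Reasoning

    ⊛-cancelʳ : ∀ {a b L} → EventuallyPositive L → a ⊛ L ≃ b ⊛ L → a ≃ b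
    ⊛-cancelʳ {a} {b} {L} L-positive (mk≃ aL-bL) =
      mk≃ (Negligible-cancelʳ L-positive (Negligible-resp-≗ (λ k → ring (a k) (b k) (L k)) aL-bL))
      where
      ring : ∀ a b L → a * L - b * L ≡ (a - b) * L
      ring = solve-∀ ℚ-ring

    ≃-apart : ∀ {a b} → a ≃ b → ¬ EventuallyPositive (a ⊝ b)
    ≃-apart (mk≃ a-b) = Negligible-apart a-b

    const-≃⇒≡ : ∀ {p q} → const p ≃ const q → p ≡ q
    const-≃⇒≡ {p} {q} (mk≃ p-q) = p-q≡0⇒p≡q (Negligible-const⇒≡0 (p - q) p-q)

    lo-bounded : Bounded lo
    lo-bounded = 2ℚ , λ k → subst (_≤ 2ℚ) (sym (ℚ.0≤p⇒∣p∣≡p (0≤lo k)))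
                                 (ℚ.≤-trans (lower≤upper (bracket k)) (upper≤2 (bracket k)))

    -- ⟦ p ⟧ approximates p(ρ) along the lower ends of the bisection intervals.
    ⟦_⟧ : Poly → Seq
    ⟦ p ⟧ k = eval p (lo k)

    ⟦⊖⟧ : ∀ p q → ⟦ p ⊖ q ⟧ ≗ ⟦ p ⟧ ⊝ ⟦ q ⟧
    ⟦⊖⟧ p q k = eval-⊖ p q (lo k)

    lowerBound≡lowerGo : ∀ k p → lowerBound N k p ≡ lowerGo (lo k) (hi k) p 1ℚ 1ℚ
    lowerBound≡lowerGo k p with rhoInterval N k
    ... | (l , u) = refl

    upperBound≡upperGo : ∀ k p → upperBound N k p ≡ upperGo (lo k) (hi k) p 1ℚ 1ℚ
    upperBound≡upperGo k p with rhoInterval N k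
    ... | (l , u) = refl

    enclosure-at : ∀ {k k′} p → k ℕ.≤ k′ →
                   lowerGo (lo k) (hi k) p 1ℚ 1ℚ ≤ ⟦ p ⟧ k′ × ⟦ p ⟧ k′ ≤ upperGo (lo k) (hi k) p 1ℚ 1ℚ
    enclosure-at {k} {k′} p k≤k′ =
      subst (lowerGo (lo k) (hi k) p 1ℚ 1ℚ ≤_) (ℚ.*-identityˡ _) (proj₁ bounds) ,
      subst (_≤ upperGo (lo k) (hi k) p 1ℚ 1ℚ) (ℚ.*-identityˡ _) (proj₂ bounds)
      where
      bounds : lowerGo (lo k) (hi k) p 1ℚ 1ℚ ≤ 1ℚ * ⟦ p ⟧ k′ × 1ℚ * ⟦ p ⟧ k′ ≤ upperGo (lo k) (hi k) p 1ℚ 1ℚ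
      bounds = interval-enclosure p 0≤1ℚ ℚ.≤-refl ℚ.≤-refl (0≤lo k) (proj₁ (nested k≤k′))
                 (ℚ.≤-trans (lower≤upper (bracket k′)) (proj₂ (nested k≤k′)))

    straddles-0⇒≃0 : ∀ p → (∀ k → lowerGo (lo k) (hi k) p 1ℚ 1ℚ ≤ 0ℚ × 0ℚ ≤ upperGo (lo k) (hi k) p 1ℚ 1ℚ) →
                     ⟦ p ⟧ ≃ const 0ℚ
    straddles-0⇒≃0 p straddles = mk≃ (0 , enclosureWidth p 1ℚ 0ℚ , λ k _ → begin
      ∣ ⟦ p ⟧ k - 0ℚ ∣                           ≡⟨ cong ∣_∣ (ℚ.+-identityʳ (⟦ p ⟧ k)) ⟩
      ∣ ⟦ p ⟧ k ∣                                ≤⟨ ∣p∣≤u-l (proj₁ (enclosure-at {k} p ℕ.≤-refl)) (proj₂ (enclosure-at {k} p ℕ.≤-refl))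
                                                            (proj₁ (straddles k)) (proj₂ (straddles k)) ⟩
      upperGo (lo k) (hi k) p 1ℚ 1ℚ - lowerGo (lo k) (hi k) p 1ℚ 1ℚ
                                                 ≤⟨ interval-width p 0≤1ℚ ℚ.≤-refl ℚ.≤-refl (ℚ.≤-reflexive (sym (ℚ.*-zeroˡ (width k))))
                                                      ℚ.≤-refl (0≤lo k) (lower≤upper (bracket k)) (upper≤2 (bracket k)) ⟩
      enclosureWidth p 1ℚ 0ℚ * width k            ∎)
      where open ℚ.≤-Reasoning

    zeroAtRho⇒≃0 : ∀ p → ZeroAtRho N p → ⟦ p ⟧ ≃ const 0ℚ
    zeroAtRho⇒≃0 p p[ρ]≡0 = straddles-0⇒≃0 p λ k →
      subst (_≤ 0ℚ) (lowerBound≡lowerGo k p) (proj₁ (p[ρ]≡0 k)) , subst (0ℚ ≤_) (upperBound≡upperGo k p) (proj₂ (p[ρ]≡0 k))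

    zeroAtRho⇒≃ : ∀ p q → ZeroAtRho N (p ⊖ q) → ⟦ p ⟧ ≃ ⟦ q ⟧
    zeroAtRho⇒≃ p q p-q≡0 = mk≃ (Negligible-resp-≗ (λ k → trans (ℚ.+-identityʳ _) (⟦⊖⟧ p q k))
                                                   (negligible (zeroAtRho⇒≃0 (p ⊖ q) p-q≡0)))

    posAtRho⇒eventuallyPositive : ∀ p → PosAtRho N p → EventuallyPositive ⟦ p ⟧
    posAtRho⇒eventuallyPositive p (k , 0<lower) =
      lowerGo (lo k) (hi k) p 1ℚ 1ℚ , subst (0ℚ <_) (lowerBound≡lowerGo k p) 0<lower , k ,
      λ k′ k≤k′ → proj₁ (enclosure-at p k≤k′)

    ⟦⟧-at-limit : ∀ {r} → lo ≃ const r → ∀ p → ⟦ p ⟧ ≃ const (eval p r)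
    ⟦⟧-at-limit lo≃r [] = ≃-refl
    ⟦⟧-at-limit {r} lo≃r (c ∷ p) = begin
      const c ⊕ lo ⊛ ⟦ p ⟧                  ≈⟨ ⊕-cong (≃-refl {const c}) (⊛-congˡ lo-bounded (⟦⟧-at-limit lo≃r p)) ⟩
      const c ⊕ lo ⊛ const (eval p r)       ≈⟨ ⊕-cong (≃-refl {const c}) (⊛-congʳ (const-bounded (eval p r)) lo≃r) ⟩
      const c ⊕ const r ⊛ const (eval p r)  ∎
      where open ≃-Reasoning

    ⟦charPoly⟧≃0 : ⟦ charPolyCoeffs N ⟧ ≃ const 0ℚ
    ⟦charPoly⟧≃0 = straddles-0⇒≃0 P λ k →
      ℚ.≤-trans (proj₁ (enclosure-at {k} P ℕ.≤-refl))
                (subst (_≤ 0ℚ) (sym (eval-charPolyCoeffs N (lo k))) (P[lower]≤0 (bracket k))) ,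
      ℚ.≤-trans (subst (0ℚ ≤_) (sym (eval-charPolyCoeffs N (hi k))) (0≤P[upper] (bracket k)))
                (subst (_≤ upperGo (lo k) (hi k) P 1ℚ 1ℚ) (ℚ.*-identityˡ _)
                       (proj₂ (interval-enclosure P 0≤1ℚ ℚ.≤-refl ℚ.≤-refl (0≤lo k) (lower≤upper (bracket k)) ℚ.≤-refl)))
      where
      P : Poly
      P = charPolyCoeffs N

    limit-is-root : ∀ {r} → lo ≃ const r → charPoly N r ≡ 0ℚ
    limit-is-root {r} lo≃r = trans (sym (eval-charPolyCoeffs N r))
      (const-≃⇒≡ (≃-trans (≃-sym (⟦⟧-at-limit lo≃r (charPolyCoeffs N))) ⟦charPoly⟧≃0))

    limit-nonNeg : ∀ {r} → lo ≃ const r → 0ℚ ≤ r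
    limit-nonNeg {r} lo≃r with 0ℚ ℚ.≤? r
    ... | yes 0≤r = 0≤r
    ... | no 0≰r  = ⊥-elim (≃-apart lo≃r (- r , ℚ.neg-antimono-< (ℚ.≰⇒> 0≰r) , 0 , λ k _ → ≤-by (ring (lo k) r) (0≤lo k)))
      where
      ring : ∀ l r → l - r - (- r) ≡ l
      ring = solve-∀ ℚ-ring

    lo-irrational : 2 ℕ.≤ N → ∀ r → ¬ (lo ≃ const r)
    lo-irrational 2≤N r lo≃r = charPoly-no-nonNeg-root 2≤N r (limit-nonNeg lo≃r) (limit-is-root lo≃r)

    no-linear-relation : 2 ℕ.≤ N → ∀ {c} d → c ≢ 0ℚ → ¬ (const c ⊛ lo ≃ const d)
    no-linear-relation 2≤N {c} d c≢0 clo≃d = lo-irrational 2≤N (1/c * d) (begin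
      lo                          ≈⟨ ≗⇒≃ (λ k → ring (lo k)) ⟩
      const 1/c ⊛ (const c ⊛ lo)  ≈⟨ ⊛-congˡ (const-bounded 1/c) clo≃d ⟩
      const 1/c ⊛ const d         ∎)
      where
      open ≃-Reasoning
      instance
        c-nonZero : ℚ.NonZero c
        c-nonZero = ℚ.≢-nonZero c≢0
      1/c : ℚ
      1/c = 1/ c
      ring : ∀ l → l ≡ 1/c * (c * l)
      ring l = trans (sym (ℚ.*-identityˡ l)) (trans (cong (_* l) (sym (ℚ.*-inverseˡ c))) (ℚ.*-assoc 1/c c l))

  module NotPeriodic {N} (2≤N : 2 ℕ.≤ N) (x : ℕ → Digits)
    (increasing : ∀ i → PosAtRho N (digitsPoly (x (suc i)) ⊖ digitsPoly (x i)))
    (complete : ∀ d → ∃ λ i → ZeroAtRho N (digitsPoly d ⊖ digitsPoly (x i)))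
    (m : ℕ) (1≤m : 1 ℕ.≤ m)
    (periodic : ∀ i → 1 ℕ.≤ i → ZeroAtRho N (tileLength x i ⊖ tileLength x (i ℕ.+ m)))
    where

    open Approximation (ℕ.<⇒≤ 2≤N)
    open ≃-Reasoning

    instance
      m≢0 : ℕ.NonZero m
      m≢0 = ℕ.>-nonZero 1≤m

    X : ℕ → Seq
    X i = ⟦ digitsPoly (x i) ⟧

    period : Seq
    period = X m ⊝ X 0

    tiles-periodic : ∀ j → X (suc j) ⊝ X j ≃ X (suc j ℕ.+ m) ⊝ X (j ℕ.+ m)
    tiles-periodic j = begin
      X (suc j) ⊝ X j                   ≈⟨ ≗⇒≃ (⟦⊖⟧ (digitsPoly (x (suc j))) (digitsPoly (x j))) ⟨
      ⟦ tileLength x (suc j) ⟧          ≈⟨ zeroAtRho⇒≃ (tileLength x (suc j)) (tileLength x (suc j ℕ.+ m)) (periodic (suc j) (ℕ.s≤s ℕ.z≤n)) ⟩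
      ⟦ tileLength x (suc j ℕ.+ m) ⟧    ≈⟨ ≗⇒≃ (⟦⊖⟧ (digitsPoly (x (suc j ℕ.+ m))) (digitsPoly (x (j ℕ.+ m)))) ⟩
      X (suc j ℕ.+ m) ⊝ X (j ℕ.+ m)     ∎

    shift-by-period : ∀ i → X (i ℕ.+ m) ≃ X i ⊕ period
    shift-by-period zero = ≗⇒≃ (λ k → ring (X 0 k) (X m k))
      where
      ring : ∀ a b → b ≡ a + (b - a)
      ring = solve-∀ ℚ-ring
    shift-by-period (suc i) = begin
      X (suc i ℕ.+ m)                                 ≈⟨ ≗⇒≃ (λ k → ring₁ (X (i ℕ.+ m) k) (X (suc i ℕ.+ m) k)) ⟩
      X (i ℕ.+ m) ⊕ (X (suc i ℕ.+ m) ⊝ X (i ℕ.+ m))   ≈⟨ ⊕-cong (shift-by-period i) (≃-sym (tiles-periodic i)) ⟩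
      (X i ⊕ period) ⊕ (X (suc i) ⊝ X i)              ≈⟨ ≗⇒≃ (λ k → ring₂ (X i k) (X (suc i) k) (period k)) ⟩
      X (suc i) ⊕ period                              ∎
      where
      ring₁ : ∀ a b → b ≡ a + (b - a)
      ring₁ = solve-∀ ℚ-ring
      ring₂ : ∀ a b p → a + p + (b - a) ≡ b + p
      ring₂ = solve-∀ ℚ-ring

    shift-by-periods : ∀ q r → X (q ℕ.* m ℕ.+ r) ≃ X r ⊕ const (fromℕ q) ⊛ period
    shift-by-periods zero r = ≗⇒≃ (λ k → ring (X r k) (period k))
      where
      ring : ∀ a p → a ≡ a + 0ℚ * p
      ring = solve-∀ ℚ-ring
    shift-by-periods (suc q) r = begin
      X (suc q ℕ.* m ℕ.+ r)                            ≡⟨ cong X (index q m r) ⟩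
      X (q ℕ.* m ℕ.+ r ℕ.+ m)                          ≈⟨ shift-by-period (q ℕ.* m ℕ.+ r) ⟩
      X (q ℕ.* m ℕ.+ r) ⊕ period                       ≈⟨ ⊕-cong (shift-by-periods q r) (≃-refl {period}) ⟩
      X r ⊕ const (fromℕ q) ⊛ period ⊕ period          ≈⟨ ≗⇒≃ (λ k → ring (X r k) (fromℕ q) (period k)) ⟩
      X r ⊕ const (1ℚ + fromℕ q) ⊛ period              ≡⟨ cong (λ c → X r ⊕ const c ⊛ period) (fromℕ-suc q) ⟨
      X r ⊕ const (fromℕ (suc q)) ⊛ period             ∎
      where
      index : ∀ q m r → suc q ℕ.* m ℕ.+ r ≡ q ℕ.* m ℕ.+ r ℕ.+ m
      index = ℕ-Solver.solve-∀
      ring : ∀ a q p → a + q * p + p ≡ a + (1ℚ + q) * p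
      ring = solve-∀ ℚ-ring

    division-by-period : ∀ j → X j ≃ X (j % m) ⊕ const (fromℕ (j / m)) ⊛ period
    division-by-period j = begin
      X j                                       ≡⟨ cong X (trans (m≡m%n+[m/n]*n j m) (ℕ.+-comm (j % m) _)) ⟩
      X (j / m ℕ.* m ℕ.+ j % m)                 ≈⟨ shift-by-periods (j / m) (j % m) ⟩
      X (j % m) ⊕ const (fromℕ (j / m)) ⊛ period ∎

    period-positive : EventuallyPositive period
    period-positive = subst (λ n → EventuallyPositive (X n ⊝ X 0)) (ℕ.suc-pred m) (gap-positive (ℕ.pred m))
      where
      step-positive : ∀ i → EventuallyPositive (X (suc i) ⊝ X i)
      step-positive i = EventuallyPositive-resp-≗ (⟦⊖⟧ (digitsPoly (x (suc i))) (digitsPoly (x i)))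
                          (posAtRho⇒eventuallyPositive (digitsPoly (x (suc i)) ⊖ digitsPoly (x i)) (increasing i))
      gap-positive : ∀ n → EventuallyPositive (X (suc n) ⊝ X 0)
      gap-positive zero    = step-positive 0
      gap-positive (suc n) = EventuallyPositive-resp-≗ (λ k → ring (X (suc (suc n)) k) (X (suc n) k) (X 0 k))
                               (EventuallyPositive-+ (step-positive (suc n)) (gap-positive n))
        where
        ring : ∀ a b c → a - b + (b - c) ≡ a - c
        ring = solve-∀ ℚ-ring

    scale-by-ρ : ∀ j → ∃ λ j′ → lo ⊛ X j ≃ X j′
    scale-by-ρ j = j′ , (begin
      lo ⊛ X j                                ≈⟨ ≗⇒≃ (λ k → eval-digitsPoly-shift (x j) (lo k)) ⟨
      ⟦ digitsPoly (x j ++ false ∷ []) ⟧       ≈⟨ zeroAtRho⇒≃ (digitsPoly (x j ++ false ∷ [])) (digitsPoly (x j′)) j′-zero ⟩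
      X j′                                    ∎)
      where
      j′ : ℕ
      j′ = proj₁ (complete (x j ++ false ∷ []))
      j′-zero : ZeroAtRho N (digitsPoly (x j ++ false ∷ []) ⊖ digitsPoly (x j′))
      j′-zero = proj₂ (complete (x j ++ false ∷ []))

    scaled-index : ℕ → ℕ
    scaled-index a = proj₁ (scale-by-ρ (a ℕ.* m ℕ.+ 0))

    scaled-multiple : ∀ a → lo ⊛ (X 0 ⊕ const (fromℕ a) ⊛ period)
                            ≃ X (scaled-index a % m) ⊕ const (fromℕ (scaled-index a / m)) ⊛ period
    scaled-multiple a = begin
      lo ⊛ (X 0 ⊕ const (fromℕ a) ⊛ period)
        ≈⟨ ⊛-congˡ lo-bounded (shift-by-periods a 0) ⟨
      lo ⊛ X (a ℕ.* m ℕ.+ 0)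
        ≈⟨ proj₂ (scale-by-ρ (a ℕ.* m ℕ.+ 0)) ⟩
      X (scaled-index a)
        ≈⟨ division-by-period (scaled-index a) ⟩
      X (scaled-index a % m) ⊕ const (fromℕ (scaled-index a / m)) ⊛ period
        ∎

    contradiction : ⊥
    contradiction with Fin.pigeonhole (ℕ.n<1+n m) (λ a → fromℕ< (m%n<n (scaled-index (toℕ a)) m))
    ... | a₁ , a₂ , a₁<a₂ , same-residue =
      no-linear-relation 2≤N (q₂ - q₁) c≢0 (⊛-cancelʳ period-positive (begin
        const c ⊛ lo ⊛ period
          ≈⟨ ≗⇒≃ (λ k → ring₁ (lo k) (X 0 k) n₁ n₂ (period k)) ⟩
        lo ⊛ (X 0 ⊕ const n₂ ⊛ period) ⊝ lo ⊛ (X 0 ⊕ const n₁ ⊛ period)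
          ≈⟨ ⊝-cong (scaled-multiple (toℕ a₂)) (scaled-multiple (toℕ a₁)) ⟩
        (X r₂ ⊕ const q₂ ⊛ period) ⊝ (X r₁ ⊕ const q₁ ⊛ period)
          ≡⟨ cong (λ r → (X r ⊕ const q₂ ⊛ period) ⊝ (X r₁ ⊕ const q₁ ⊛ period)) r₂≡r₁ ⟩
        (X r₁ ⊕ const q₂ ⊛ period) ⊝ (X r₁ ⊕ const q₁ ⊛ period)
          ≈⟨ ≗⇒≃ (λ k → ring₂ (X r₁ k) q₁ q₂ (period k)) ⟩
        const (q₂ - q₁) ⊛ period
          ∎))
      where
      n₁ n₂ c q₁ q₂ : ℚ
      r₁ r₂ : ℕ
      n₁ = fromℕ (toℕ a₁)
      n₂ = fromℕ (toℕ a₂)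
      c = n₂ - n₁
      r₁ = scaled-index (toℕ a₁) % m
      r₂ = scaled-index (toℕ a₂) % m
      q₁ = fromℕ (scaled-index (toℕ a₁) / m)
      q₂ = fromℕ (scaled-index (toℕ a₂) / m)
      r₂≡r₁ : r₂ ≡ r₁
      r₂≡r₁ = trans (sym (Fin.toℕ-fromℕ< _)) (trans (cong toℕ (sym same-residue)) (Fin.toℕ-fromℕ< _))
      c≢0 : c ≢ 0ℚ
      c≢0 c≡0 = ℕ.<-irrefl (sym (fromℕ-injective (p-q≡0⇒p≡q c≡0))) a₁<a₂
      ring₁ : ∀ l x n₁ n₂ p → (n₂ - n₁) * l * p ≡ l * (x + n₂ * p) - l * (x + n₁ * p)
      ring₁ = solve-∀ ℚ-ring
      ring₂ : ∀ x q₁ q₂ p → x + q₂ * p - (x + q₁ * p) ≡ (q₂ - q₁) * p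
      ring₂ = solve-∀ ℚ-ring

open import Defs
open import Data.Nat using (ℕ; suc; _≤_; _+_)
open import Data.Product using (_×_; ∃; _,_)
open import Relation.Nullary using (¬_)

corollary4p11 : (N : ℕ) → 2 ≤ N → (x : ℕ → Digits)
    → ZeroAtRho N (digitsPoly (x 0))
    → (∀ i → PosAtRho N (digitsPoly (x (suc i)) ⊖ digitsPoly (x i)))
    → (∀ (d : Digits) → ∃ λ i → ZeroAtRho N (digitsPoly d ⊖ digitsPoly (x i)))
    → ¬ (∃ λ m → (1 ≤ m) × (∀ i → 1 ≤ i → ZeroAtRho N (tileLength x i ⊖ tileLength x (i + m))))
corollary4p11 N 2≤N x _ increasing complete (m , 1≤m , periodic) =
  ρ-Tiling.NotPeriodic.contradiction 2≤N x increasing complete m 1≤m periodic
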